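{- For $n\ge0$ let $E^{A_3}(n)$ be the number of $W_2$-hesitating lattice walks of length $2n$ that start at some point of the form $(i,0)$ with $i\ge1$ and end at $(1,0)$. Then $E^{A_3}(0)=1$, $E^{A_3}(1)=2$, and for all $n\ge 0$ \[ 8(n+1)(n+2)E^{A_3}(n)+(7n^2+49n+82)E^{A_3}(n+1)-(n+5)(n+6)E^{A_3}(n+2)=0. \] Equivalently, $\mathcal{E}^{A_3}(t)=\sum_{n\ge0}E^{A_3}(n)t^n$ satisfies \[ 12+4(-3+10t+4t^2)\mathcal{E}^{A_3}(t)+2t(-4+21t+16t^2)\frac{d}{dt}\mathcal{E}^{A_3}(t)+t^2(t+1)(8t-1)\frac{d^2}{dt^2}\mathcal{E}^{A_3}(t)=0. \]
   Context: $W_2=\{(a_1,a_2)\in\mathbb{Z}^2:a_1>a_2\ge0\}$, $e_1=(1,0)$, $e_2=(0,1)$. A $W_2$-hesitating lattice walk of length $2n$ is a sequence $p_0,p_1,\dots,p_{2n}$ of points of $W_2$ such that for each $m=0,\dots,n-1$ the pair of steps $(p_{2m+1}-p_{2m},\,p_{2m+2}-p_{2m+1})$ is of one of the forms: $(0,e_i)$; $(-e_i,0)$; or $(e_i,-e_j)$, for some $i,j\in\{1,2\}$. -}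

module Defs where

open import Data.Nat using (ℕ; zero; suc; _+_; _<_)
open import Data.Fin using (Fin; zero; suc)
open import Data.Product using (_×_; _,_)
open import Relation.Binary.PropositionalEquality using (_≡_)

-- Points of ℤ² that can lie in W₂ have nonnegative coordinates, so we use ℕ × ℕ.
Point : Set
Point = ℕ × ℕ

InW : Point → Set
InW (a₁ , a₂) = a₂ < a₁

e : Fin 2 → Point
e zero       = (1 , 0)
e (suc zero) = (0 , 1)

_⊕_ : Point → Point → Point
(a , b) ⊕ (c , d) = (a + c , b + d)

-- HPair p q r : the pair of steps (q - p , r - q) has one of the allowed forms
data HPair : Point → Point → Point → Set where
  stay-up   : (p : Point) (i : Fin 2) → HPair p p (p ⊕ e i)
  down-stay : (q : Point) (i : Fin 2) → HPair (q ⊕ e i) q q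
  up-down   : (r : Point) (p : Point) (i j : Fin 2) →
              p ⊕ e i ≡ r ⊕ e j → HPair p (p ⊕ e i) r               -- (e_i , -e_j)

-- HWalk n p s : W₂-hesitating walks of length 2n from p to s, i.e. sequences
-- p = p₀, p₁, …, p₂ₙ = s of points of W₂ whose consecutive step pairs are allowed.
data HWalk : ℕ → Point → Point → Set where
  done : {p : Point} → InW p → HWalk zero p p
  step : {n : ℕ} {p q r s : Point} → InW p → InW q →
         HPair p q r → HWalk n r s → HWalk (suc n) p s

-- A pair of hesitating steps moves by one of the net steps ±e₁, ±e₂, 0, 0, ±(e₁ - e₂), a set invariant
-- under the dihedral group of order 12 generated by (a , b) ↦ (b , a) and (a , b) ↦ (a + b , -b).  Inside
-- W₂ the number of hesitating walks from p to (1 , 0) satisfies the same recursion as the number of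
-- unrestricted walks, and the walls a = b and b = -1 of W₂ are mirrors of an affine copy of that group;
-- so, by the reflection principle, it is the signed sum of unrestricted walk counts from the twelve
-- points of the orbit of (1 , 0).  Summed over the starting points (i , 0), these terms telescope along
-- the axis, leaving a fixed integer combination B(n) of unrestricted counts U(n , p).  Finally U
-- satisfies, for every linear π, the relation Σₛ (π(d) - (n + 1) π(s)) U(n , d - s) = 0, and an explicit
-- combination of sixteen of these relations equals the recurrence for B as a linear form in the values
-- U(n , p), up to the symmetries of U; this is checked by computing a normal form.

module Submission where

open import Defs
open import Agda.Builtin.FromNat using (fromNat)
open import Data.Unit using (tt)
open import Data.Nat.Literals using () renaming (number to ℕ-number)
open import Data.Integer.Literals using () renaming (number to ℤ-number; negative to ℤ-negative)

instance
  _ = ℕ-number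
  _ = ℤ-number
  _ = ℤ-negative

module IntegerSums where

  open import Data.Nat using (ℕ; zero; suc)
  import Data.Nat as ℕ
  import Data.Nat.Properties as ℕ
  open import Data.Integer using (ℤ; +_; 0ℤ; _+_; _*_; -_; _-_)
  open import Data.Integer.Properties
    using (*-zeroʳ; *-distribˡ-+; +-identityˡ; +-identityʳ; +-assoc; neg-distrib-+; +-inverseʳ; i*j≡0⇒i≡0∨j≡0)
  open import Data.Integer.Tactic.RingSolver using (solve-∀)
  open import Data.Sum using ([_,_]′)
  open import Data.List using (List; []; _∷_; [_]; _++_; map; concatMap; upTo)
  open import Data.List.Properties using (upTo-∷ʳ)
  open import Data.List.Relation.Unary.All using (All; []; _∷_; universal)
  open import Relation.Binary.PropositionalEquality using (_≡_; refl; sym; trans; cong; cong₂; module ≡-Reasoning)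

  ∑ : {A : Set} → List A → (A → ℤ) → ℤ
  ∑ []       f = 0ℤ
  ∑ (x ∷ xs) f = f x + ∑ xs f

  module _ {A : Set} where

    ∑-cong : (xs : List A) {f g : A → ℤ} → (∀ x → f x ≡ g x) → ∑ xs f ≡ ∑ xs g
    ∑-cong []       f≗g = refl
    ∑-cong (x ∷ xs) f≗g = cong₂ _+_ (f≗g x) (∑-cong xs f≗g)

    ∑-cong-All : (xs : List A) {f g : A → ℤ} → All (λ x → f x ≡ g x) xs → ∑ xs f ≡ ∑ xs g
    ∑-cong-All []       []           = refl
    ∑-cong-All (x ∷ xs) (fx≡gx ∷ h) = cong₂ _+_ fx≡gx (∑-cong-All xs h)

    ∑-zero : (xs : List A) {f : A → ℤ} → All (λ x → f x ≡ 0ℤ) xs → ∑ xs f ≡ 0ℤ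
    ∑-zero []       []         = refl
    ∑-zero (x ∷ xs) (fx≡0 ∷ h) = cong₂ _+_ fx≡0 (∑-zero xs h)

    ∑-map : {B : Set} (g : B → A) (xs : List B) (f : A → ℤ) → ∑ (map g xs) f ≡ ∑ xs (λ x → f (g x))
    ∑-map g []       f = refl
    ∑-map g (x ∷ xs) f = cong (_+_ (f (g x))) (∑-map g xs f)

    ∑-+ : (xs : List A) (f g : A → ℤ) → ∑ xs (λ x → f x + g x) ≡ ∑ xs f + ∑ xs g
    ∑-+ []       f g = refl
    ∑-+ (x ∷ xs) f g = trans (cong (_+_ (f x + g x)) (∑-+ xs f g)) (interchange (f x) (g x) _ _)
      where
      interchange : ∀ a b c d → (a + b) + (c + d) ≡ (a + c) + (b + d)
      interchange = solve-∀

    ∑-* : (xs : List A) (c : ℤ) (f : A → ℤ) → ∑ xs (λ x → c * f x) ≡ c * ∑ xs f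
    ∑-* []       c f = sym (*-zeroʳ c)
    ∑-* (x ∷ xs) c f = trans (cong (_+_ (c * f x)) (∑-* xs c f)) (sym (*-distribˡ-+ c (f x) (∑ xs f)))

    ∑-neg : (xs : List A) (f : A → ℤ) → ∑ xs (λ x → - f x) ≡ - ∑ xs f
    ∑-neg []       f = refl
    ∑-neg (x ∷ xs) f = trans (cong (_+_ (- f x)) (∑-neg xs f)) (sym (neg-distrib-+ (f x) (∑ xs f)))

    ∑-++ : (xs ys : List A) (f : A → ℤ) → ∑ (xs ++ ys) f ≡ ∑ xs f + ∑ ys f
    ∑-++ []       ys f = sym (+-identityˡ (∑ ys f))
    ∑-++ (x ∷ xs) ys f = trans (cong (_+_ (f x)) (∑-++ xs ys f)) (sym (+-assoc (f x) _ _))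

  ∑-concatMap : {A B : Set} (h : A → List B) (xs : List A) (f : B → ℤ) →
                ∑ (concatMap h xs) f ≡ ∑ xs (λ x → ∑ (h x) f)
  ∑-concatMap h []       f = refl
  ∑-concatMap h (x ∷ xs) f = trans (∑-++ (h x) (concatMap h xs) f) (cong (_+_ (∑ (h x) f)) (∑-concatMap h xs f))

  ∑-comm : {A B : Set} (xs : List A) (ys : List B) (f : A → B → ℤ) →
           ∑ xs (λ x → ∑ ys (f x)) ≡ ∑ ys (λ y → ∑ xs (λ x → f x y))
  ∑-comm []       ys f = sym (∑-zero ys (universal (λ _ → refl) ys))
  ∑-comm (x ∷ xs) ys f =
    trans (cong (_+_ (∑ ys (f x))) (∑-comm xs ys f)) (sym (∑-+ ys (f x) (λ y → ∑ xs (λ x → f x y))))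

  ∑-upTo-suc : ∀ N (f : ℕ → ℤ) → ∑ (upTo (suc N)) f ≡ ∑ (upTo N) f + f N
  ∑-upTo-suc N f = begin
    ∑ (upTo (suc N)) f           ≡⟨ cong (λ xs → ∑ xs f) (sym (upTo-∷ʳ N)) ⟩
    ∑ (upTo N ++ [ N ]) f        ≡⟨ ∑-++ (upTo N) [ N ] f ⟩
    ∑ (upTo N) f + (f N + 0ℤ)    ≡⟨ cong (_+_ (∑ (upTo N) f)) (+-identityʳ (f N)) ⟩
    ∑ (upTo N) f + f N           ∎
    where open ≡-Reasoning

  ∑-window-shift : ∀ (g : ℕ → ℤ) k N →
    ∑ (upTo k) (λ j → g (suc N ℕ.+ j)) ≡ ∑ (upTo k) (λ j → g (N ℕ.+ j)) + g (N ℕ.+ k) - g N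
  ∑-window-shift g zero N = sym (trans (cong (λ x → 0ℤ + g x - g N) (ℕ.+-identityʳ N)) (cancel (g N)))
    where
    cancel : ∀ x → 0ℤ + x - x ≡ 0ℤ
    cancel = solve-∀
  ∑-window-shift g (suc k) N = begin
      ∑ (upTo (suc k)) (λ j → g (suc N ℕ.+ j))
    ≡⟨ ∑-upTo-suc k (λ j → g (suc N ℕ.+ j)) ⟩
      ∑ (upTo k) (λ j → g (suc N ℕ.+ j)) + g (suc N ℕ.+ k)
    ≡⟨ cong₂ _+_ (∑-window-shift g k N) (cong g (sym (ℕ.+-suc N k))) ⟩
      ∑ (upTo k) (λ j → g (N ℕ.+ j)) + g (N ℕ.+ k) - g N + g (N ℕ.+ suc k)
    ≡⟨ regroup (∑ (upTo k) (λ j → g (N ℕ.+ j))) (g (N ℕ.+ k)) (g N) (g (N ℕ.+ suc k)) ⟩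
      ∑ (upTo k) (λ j → g (N ℕ.+ j)) + g (N ℕ.+ k) + g (N ℕ.+ suc k) - g N
    ≡⟨ cong (λ x → x + g (N ℕ.+ suc k) - g N) (sym (∑-upTo-suc k (λ j → g (N ℕ.+ j)))) ⟩
      ∑ (upTo (suc k)) (λ j → g (N ℕ.+ j)) + g (N ℕ.+ suc k) - g N
    ∎
    where
    open ≡-Reasoning
    regroup : ∀ s a b c → s + a - b + c ≡ s + a + c - b
    regroup = solve-∀

  ∑-telescope : ∀ (g : ℕ → ℤ) k N →
    ∑ (upTo N) (λ i → g i - g (i ℕ.+ k)) ≡ ∑ (upTo k) g - ∑ (upTo k) (λ j → g (N ℕ.+ j))
  ∑-telescope g k zero = sym (+-inverseʳ (∑ (upTo k) g))
  ∑-telescope g k (suc N) = begin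
      ∑ (upTo (suc N)) (λ i → g i - g (i ℕ.+ k))
    ≡⟨ ∑-upTo-suc N (λ i → g i - g (i ℕ.+ k)) ⟩
      ∑ (upTo N) (λ i → g i - g (i ℕ.+ k)) + (g N - g (N ℕ.+ k))
    ≡⟨ cong (_+ (g N - g (N ℕ.+ k))) (∑-telescope g k N) ⟩
      ∑ (upTo k) g - W + (g N - g (N ℕ.+ k))
    ≡⟨ regroup (∑ (upTo k) g) W (g N) (g (N ℕ.+ k)) ⟩
      ∑ (upTo k) g - (W + g (N ℕ.+ k) - g N)
    ≡⟨ cong (_-_ (∑ (upTo k) g)) (sym (∑-window-shift g k N)) ⟩
      ∑ (upTo k) g - ∑ (upTo k) (λ j → g (suc N ℕ.+ j))
    ∎
    where
    open ≡-Reasoning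
    W : ℤ
    W = ∑ (upTo k) (λ j → g (N ℕ.+ j))
    regroup : ∀ s w a b → s - w + (a - b) ≡ s - (w + b - a)
    regroup = solve-∀

  i≡-i⇒i≡0 : ∀ i → i ≡ - i → i ≡ 0ℤ
  i≡-i⇒i≡0 i i≡-i = [ (λ ()) , (λ i≡0 → i≡0) ]′ (i*j≡0⇒i≡0∨j≡0 (+ 2) (trans (double i) i+i≡0))
    where
    double : ∀ i → + 2 * i ≡ i + i
    double = solve-∀
    i+i≡0 : i + i ≡ 0ℤ
    i+i≡0 = trans (cong (_+_ i) i≡-i) (+-inverseʳ i)

  ∑-antisymmetric : {A : Set} (xs : List A) (h : A → ℤ) (g : A → A → ℤ) → (∀ s t → g s t ≡ g t s) →
                    ∑ xs (λ s → ∑ xs (λ t → (h t - h s) * g s t)) ≡ 0ℤ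
  ∑-antisymmetric xs h g g-sym = i≡-i⇒i≡0 _ (begin
      ∑ xs (λ s → ∑ xs (λ t → (h t - h s) * g s t))
    ≡⟨ ∑-comm xs xs (λ s t → (h t - h s) * g s t) ⟩
      ∑ xs (λ t → ∑ xs (λ s → (h t - h s) * g s t))
    ≡⟨ ∑-cong xs (λ t → ∑-cong xs (λ s → trans (cong ((h t - h s) *_) (g-sym s t)) (negate (h t) (h s) (g t s)))) ⟩
      ∑ xs (λ t → ∑ xs (λ s → - ((h s - h t) * g t s)))
    ≡⟨ ∑-cong xs (λ t → ∑-neg xs (λ s → (h s - h t) * g t s)) ⟩
      ∑ xs (λ t → - ∑ xs (λ s → (h s - h t) * g t s))
    ≡⟨ ∑-neg xs (λ t → ∑ xs (λ s → (h s - h t) * g t s)) ⟩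
      - ∑ xs (λ t → ∑ xs (λ s → (h s - h t) * g t s))
    ∎)
    where
    open ≡-Reasoning
    negate : ∀ a b x → (a - b) * x ≡ - ((b - a) * x)
    negate = solve-∀

module FreeWalks where

  open import Data.Nat using (ℕ; zero; suc; z≤n; s≤s)
  open import Data.Integer using (ℤ; +_; 0ℤ; 1ℤ; -1ℤ; _+_; _*_; -_; _-_; _≤_; _<_; +≤+; -≤+; +<+)
  open import Data.Integer.Properties
    using (+-inverseʳ; *-zeroʳ; *-identityˡ; *-identityʳ; _≟_; neg-mono-≤; +-mono-<-≤; neg-involutive; i-j≡0⇒i≡j)
  open import Data.Integer.Tactic.RingSolver using (solve-∀)
  open import Data.Product using (_×_; _,_; proj₁; proj₂)
  open import Data.Product.Properties using (≡-dec)
  open import Data.List using (List; []; _∷_)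
  open import Data.List.Relation.Unary.All as All using (All; []; _∷_)
  open import Data.Bool using (if_then_else_)
  open import Relation.Nullary using (Dec; yes; no; does; contradiction)
  open import Relation.Binary.PropositionalEquality
  open IntegerSums

  ℤ² : Set
  ℤ² = ℤ × ℤ

  _⊖_ : ℤ² → ℤ² → ℤ²
  (a , b) ⊖ (c , d) = (a - c , b - d)

  origin : ℤ²
  origin = (0ℤ , 0ℤ)

  _≟²_ : (p q : ℤ²) → Dec (p ≡ q)
  _≟²_ = ≡-dec _≟_ _≟_

  -- The displacements p₂ₘ₊₂ - p₂ₘ of the allowed step pairs (0,eᵢ), (-eᵢ,0) and (eᵢ,-eⱼ):
  -- eᵢ - eⱼ is 0 twice, for i = j = 1 and i = j = 2.
  netSteps : List ℤ²
  netSteps = (1 , 0) ∷ (0 , 1) ∷ (-1 , 0) ∷ (0 , -1) ∷ (0 , 0) ∷ (0 , 0) ∷ (1 , -1) ∷ (-1 , 1) ∷ []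

  freeWalks : ℕ → ℤ² → ℤ
  freeWalks zero    p = if does (p ≟² origin) then 1ℤ else 0ℤ
  freeWalks (suc n) p = ∑ netSteps (λ s → freeWalks n (p ⊖ s))

  p⊖p≡origin : ∀ p → p ⊖ p ≡ origin
  p⊖p≡origin (a , b) = cong₂ _,_ (+-inverseʳ a) (+-inverseʳ b)

  ⊖≡origin : ∀ {p q} → p ⊖ q ≡ origin → p ≡ q
  ⊖≡origin {a , b} {c , d} eq = cong₂ _,_ (i-j≡0⇒i≡j a c (cong proj₁ eq)) (i-j≡0⇒i≡j b d (cong proj₂ eq))

  ⊖-comm : ∀ p s t → (p ⊖ s) ⊖ t ≡ (p ⊖ t) ⊖ s
  ⊖-comm (a , b) (c , d) (e , f) = cong₂ _,_ (exchange a c e) (exchange b d f)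
    where
    exchange : ∀ a b c → (a - b) - c ≡ (a - c) - b
    exchange = solve-∀

  height : ℤ² → ℤ
  height (a , b) = a + b

  height-⊖ : ∀ p s → height (p ⊖ s) ≡ height p - height s
  height-⊖ (a , b) (c , d) = regroup a b c d
    where
    regroup : ∀ a b c d → (a - c) + (b - d) ≡ (a + b) - (c + d)
    regroup = solve-∀

  module Invariance (σ : ℤ² → ℤ²)
                    (σ-⊖ : ∀ p s → σ (p ⊖ s) ≡ σ p ⊖ σ s)
                    (σ-involutive : ∀ p → σ (σ p) ≡ p)
                    (σ-permutes-steps : ∀ f → ∑ netSteps (λ s → f (σ s)) ≡ ∑ netSteps f) where

    σ-origin : σ origin ≡ origin
    σ-origin = trans (cong σ (sym (p⊖p≡origin origin))) (trans (σ-⊖ origin origin) (p⊖p≡origin (σ origin)))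

    freeWalks-invariant : ∀ n p → freeWalks n (σ p) ≡ freeWalks n p
    freeWalks-invariant zero p with σ p ≟² origin | p ≟² origin
    ... | yes _      | yes _     = refl
    ... | no _       | no _      = refl
    ... | yes σp≡o   | no p≢o    = contradiction (trans (sym (σ-involutive p)) (trans (cong σ σp≡o) σ-origin)) p≢o
    ... | no σp≢o    | yes refl  = contradiction σ-origin σp≢o
    freeWalks-invariant (suc n) p =
      trans (sym (σ-permutes-steps (λ s → freeWalks n (σ p ⊖ s))))
            (∑-cong netSteps (λ s → trans (cong (freeWalks n) (sym (σ-⊖ p s))) (freeWalks-invariant n (p ⊖ s))))

  swapℤ² : ℤ² → ℤ²
  swapℤ² (a , b) = (b , a)

  reflectℤ² : ℤ² → ℤ²
  reflectℤ² (a , b) = (a + b , - b)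

  freeWalks-swap : ∀ n p → freeWalks n (swapℤ² p) ≡ freeWalks n p
  freeWalks-swap = Invariance.freeWalks-invariant swapℤ² (λ _ _ → refl) (λ _ → refl)
    (λ f → permute (f (1ℤ , 0ℤ)) (f (0ℤ , 1ℤ)) (f (-1ℤ , 0ℤ)) (f (0ℤ , -1ℤ)) (f origin) (f origin)
                   (f (1ℤ , -1ℤ)) (f (-1ℤ , 1ℤ)))
    where
    permute : ∀ a b c d e f g h →
      b + (a + (d + (c + (e + (f + (h + (g + 0ℤ))))))) ≡ a + (b + (c + (d + (e + (f + (g + (h + 0ℤ)))))))
    permute = solve-∀

  freeWalks-reflect : ∀ n p → freeWalks n (reflectℤ² p) ≡ freeWalks n p
  freeWalks-reflect = Invariance.freeWalks-invariant reflectℤ²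
    (λ p s → cong₂ _,_ (height-⊖ p s) (⊖-second (proj₂ p) (proj₂ s)))
    (λ (a , b) → cong₂ _,_ (cancel a b) (neg-involutive b))
    (λ f → permute (f (1ℤ , 0ℤ)) (f (0ℤ , 1ℤ)) (f (-1ℤ , 0ℤ)) (f (0ℤ , -1ℤ)) (f origin) (f origin)
                   (f (1ℤ , -1ℤ)) (f (-1ℤ , 1ℤ)))
    where
    ⊖-second : ∀ b d → - (b - d) ≡ - b - - d
    ⊖-second = solve-∀
    cancel : ∀ a b → (a + b) + - b ≡ a
    cancel = solve-∀
    permute : ∀ a b c d e f g h →
      a + (g + (c + (h + (e + (f + (b + (d + 0ℤ))))))) ≡ a + (b + (c + (d + (e + (f + (g + (h + 0ℤ)))))))
    permute = solve-∀

  freeWalks-support : ∀ n p → + n < height p → freeWalks n p ≡ 0ℤ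
  freeWalks-support zero p 0<h with p ≟² origin
  ... | yes refl with 0<h
  ...   | +<+ ()
  freeWalks-support zero p 0<h | no _ = refl
  freeWalks-support (suc n) p n<h = ∑-zero netSteps (All.map (λ {s} → below {s}) steps-low)
    where
    below : ∀ {s} → height s ≤ 1ℤ → freeWalks n (p ⊖ s) ≡ 0ℤ
    below {s} hs≤1 = freeWalks-support n (p ⊖ s)
      (subst (+ n <_) (sym (height-⊖ p s)) (+-mono-<-≤ n<h (neg-mono-≤ hs≤1)))
    steps-low : All (λ s → height s ≤ 1ℤ) netSteps
    steps-low = +≤+ (s≤s z≤n) ∷ +≤+ (s≤s z≤n) ∷ -≤+ ∷ -≤+ ∷ +≤+ z≤n ∷ +≤+ z≤n ∷ +≤+ z≤n ∷ +≤+ z≤n ∷ []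

  -- Summed over all walks of length n + 1 to d, π(d) = Σ π(steps), and by symmetry each of the n + 1
  -- step positions contributes as much as the last one.
  module Euler (π : ℤ² → ℤ) (π-⊖ : ∀ p s → π (p ⊖ s) ≡ π p - π s) where

    π-origin : π origin ≡ 0ℤ
    π-origin = trans (π-⊖ origin origin) (+-inverseʳ (π origin))

    freeWalks-euler : ∀ n d → ∑ netSteps (λ s → (π d - + suc n * π s) * freeWalks n (d ⊖ s)) ≡ 0ℤ
    freeWalks-euler zero d = ∑-zero netSteps (All.universal base-term netSteps)
      where
      base-term : ∀ s → (π d - 1ℤ * π s) * freeWalks 0 (d ⊖ s) ≡ 0ℤ
      base-term s with (d ⊖ s) ≟² origin
      ... | no _       = *-zeroʳ (π d - 1ℤ * π s)
      ... | yes d⊖s≡o = begin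
          (π d - 1ℤ * π s) * 1ℤ  ≡⟨ *-identityʳ _ ⟩
          π d - 1ℤ * π s         ≡⟨ cong (λ x → π d - x) (*-identityˡ (π s)) ⟩
          π d - π s              ≡⟨ sym (π-⊖ d s) ⟩
          π (d ⊖ s)              ≡⟨ cong π d⊖s≡o ⟩
          π origin               ≡⟨ π-origin ⟩
          0ℤ                     ∎
        where open ≡-Reasoning
    freeWalks-euler (suc n) d = begin
        ∑ netSteps (λ s → c s * ∑ netSteps (g s))
      ≡⟨ ∑-cong netSteps (λ s → sym (∑-* netSteps (c s) (g s))) ⟩
        ∑ netSteps (λ s → ∑ netSteps (λ t → c s * g s t))
      ≡⟨ ∑-cong netSteps (λ s → ∑-cong netSteps (λ t → split s t)) ⟩
        ∑ netSteps (λ s → ∑ netSteps (λ t → A s t + m * B s t))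
      ≡⟨ ∑-cong netSteps (λ s → ∑-+ netSteps (A s) (λ t → m * B s t)) ⟩
        ∑ netSteps (λ s → ∑ netSteps (A s) + ∑ netSteps (λ t → m * B s t))
      ≡⟨ ∑-+ netSteps (λ s → ∑ netSteps (A s)) (λ s → ∑ netSteps (λ t → m * B s t)) ⟩
        ∑ netSteps (λ s → ∑ netSteps (A s)) + ∑ netSteps (λ s → ∑ netSteps (λ t → m * B s t))
      ≡⟨ cong₂ _+_ (∑-zero netSteps (All.universal (λ s → freeWalks-euler n (d ⊖ s)) netSteps)) B-part ⟩
        0ℤ + m * 0ℤ
      ≡⟨ cong (_+_ 0ℤ) (*-zeroʳ m) ⟩
        0ℤ
      ∎
      where
      open ≡-Reasoning
      m : ℤ
      m = + suc n
      c : ℤ² → ℤ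
      c s = π d - + suc (suc n) * π s
      g : ℤ² → ℤ² → ℤ
      g s t = freeWalks n ((d ⊖ s) ⊖ t)
      A B : ℤ² → ℤ² → ℤ
      A s t = (π (d ⊖ s) - m * π t) * g s t
      B s t = (π t - π s) * g s t
      split : ∀ s t → c s * g s t ≡ A s t + m * B s t
      split s t rewrite π-⊖ d s = regroup (π d) (π s) (π t) (+ n) (g s t)
        where
        regroup : ∀ a b c k x →
          (a - (1ℤ + (1ℤ + k)) * b) * x ≡ ((a - b) - (1ℤ + k) * c) * x + (1ℤ + k) * ((c - b) * x)
        regroup = solve-∀
      B-part : ∑ netSteps (λ s → ∑ netSteps (λ t → m * B s t)) ≡ m * 0ℤ
      B-part = begin
          ∑ netSteps (λ s → ∑ netSteps (λ t → m * B s t))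
        ≡⟨ ∑-cong netSteps (λ s → ∑-* netSteps m (B s)) ⟩
          ∑ netSteps (λ s → m * ∑ netSteps (B s))
        ≡⟨ ∑-* netSteps m (λ s → ∑ netSteps (B s)) ⟩
          m * ∑ netSteps (λ s → ∑ netSteps (B s))
        ≡⟨ cong (m *_) (∑-antisymmetric netSteps π g (λ s t → cong (freeWalks n) (⊖-comm d s t))) ⟩
          m * 0ℤ
        ∎

module LinearForms where

  open import Data.Integer using (ℤ; 0ℤ; _+_; _*_)
  open import Data.Integer.Properties using (_≟_; *-zeroˡ; *-zeroʳ; +-identityˡ; +-identityʳ)
  open import Data.Integer.Tactic.RingSolver using (solve-∀)
  open import Data.Bool using (Bool; true; if_then_else_; _∧_; T)
  open import Data.Bool.Properties using (T-∧)
  open import Data.Product using (_×_; _,_)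
  open import Data.List using (List; []; _∷_; [_]; map; foldr)
  open import Function.Bundles using (Equivalence)
  open import Relation.Nullary using (yes; no; does)
  open import Relation.Binary.PropositionalEquality using (_≡_; refl; sym; trans; cong; cong₂; module ≡-Reasoning)
  open IntegerSums
  open FreeWalks using (ℤ²; _≟²_)

  -- Polynomials in one variable, as coefficient lists with the constant term first.
  Poly : Set
  Poly = List ℤ

  eval : Poly → ℤ → ℤ
  eval []       x = 0ℤ
  eval (c ∷ cs) x = c + x * eval cs x

  infixl 6 _⊞_
  infixl 7 _⊡_ _⊠_

  _⊞_ : Poly → Poly → Poly
  []       ⊞ q        = q
  (a ∷ p)  ⊞ []       = a ∷ p
  (a ∷ p)  ⊞ (b ∷ q)  = (a + b) ∷ (p ⊞ q)

  _⊡_ : ℤ → Poly → Poly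
  c ⊡ p = map (c *_) p

  _⊠_ : Poly → Poly → Poly
  []      ⊠ q = []
  (a ∷ p) ⊠ q = a ⊡ q ⊞ (0ℤ ∷ p ⊠ q)

  eval-constant : ∀ c x → eval [ c ] x ≡ c
  eval-constant c x = trans (cong (_+_ c) (*-zeroʳ x)) (+-identityʳ c)

  eval-⊞ : ∀ p q x → eval (p ⊞ q) x ≡ eval p x + eval q x
  eval-⊞ []      q       x = sym (+-identityˡ (eval q x))
  eval-⊞ (a ∷ p) []      x = sym (+-identityʳ _)
  eval-⊞ (a ∷ p) (b ∷ q) x = trans (cong (λ v → (a + b) + x * v) (eval-⊞ p q x)) (regroup a b x (eval p x) (eval q x))
    where
    regroup : ∀ a b x u v → (a + b) + x * (u + v) ≡ (a + x * u) + (b + x * v)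
    regroup = solve-∀

  eval-⊡ : ∀ c p x → eval (c ⊡ p) x ≡ c * eval p x
  eval-⊡ c []      x = sym (*-zeroʳ c)
  eval-⊡ c (a ∷ p) x = trans (cong (λ v → c * a + x * v) (eval-⊡ c p x)) (regroup c a x (eval p x))
    where
    regroup : ∀ c a x u → c * a + x * (c * u) ≡ c * (a + x * u)
    regroup = solve-∀

  eval-⊠ : ∀ p q x → eval (p ⊠ q) x ≡ eval p x * eval q x
  eval-⊠ []      q x = sym (*-zeroˡ (eval q x))
  eval-⊠ (a ∷ p) q x = begin
      eval (a ⊡ q ⊞ (0ℤ ∷ p ⊠ q)) x
    ≡⟨ eval-⊞ (a ⊡ q) (0ℤ ∷ p ⊠ q) x ⟩
      eval (a ⊡ q) x + (0ℤ + x * eval (p ⊠ q) x)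
    ≡⟨ cong₂ (λ u v → u + (0ℤ + x * v)) (eval-⊡ a q x) (eval-⊠ p q x) ⟩
      a * eval q x + (0ℤ + x * (eval p x * eval q x))
    ≡⟨ regroup a x (eval p x) (eval q x) ⟩
      (a + x * eval p x) * eval q x
    ∎
    where
    open ≡-Reasoning
    regroup : ∀ a x u v → a * v + (0ℤ + x * (u * v)) ≡ (a + x * u) * v
    regroup = solve-∀

  Form : Set
  Form = List (Poly × ℤ²)

  ⟦_⟧ : Form → ℤ → (ℤ² → ℤ) → ℤ
  ⟦ φ ⟧ x u = ∑ φ (λ (c , p) → eval c x * u p)

  scale : Poly → Form → Form
  scale c = map (λ (d , p) → c ⊠ d , p)

  ⟦scale⟧ : ∀ c φ x u → ⟦ scale c φ ⟧ x u ≡ eval c x * ⟦ φ ⟧ x u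
  ⟦scale⟧ c []            x u = sym (*-zeroʳ (eval c x))
  ⟦scale⟧ c ((d , p) ∷ φ) x u =
    trans (cong₂ _+_ (cong (_* u p) (eval-⊠ c d x)) (⟦scale⟧ c φ x u)) (regroup (eval c x) (eval d x) (u p) (⟦ φ ⟧ x u))
    where
    regroup : ∀ c d v w → (c * d) * v + c * w ≡ c * (d * v + w)
    regroup = solve-∀

  isZeroPoly : Poly → Bool
  isZeroPoly []       = true
  isZeroPoly (c ∷ cs) = does (c ≟ 0ℤ) ∧ isZeroPoly cs

  isZeroPoly-sound : ∀ p x → T (isZeroPoly p) → eval p x ≡ 0ℤ
  isZeroPoly-sound []       x _ = refl
  isZeroPoly-sound (c ∷ cs) x h with c ≟ 0ℤ
  ... | yes refl = trans (+-identityˡ _) (trans (cong (x *_) (isZeroPoly-sound cs x h)) (*-zeroʳ x))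

  isZero : Form → Bool
  isZero []            = true
  isZero ((c , _) ∷ φ) = isZeroPoly c ∧ isZero φ

  isZero-sound : ∀ φ x u → T (isZero φ) → ⟦ φ ⟧ x u ≡ 0ℤ
  isZero-sound []            x u _ = refl
  isZero-sound ((c , p) ∷ φ) x u h with Equivalence.to T-∧ h
  ... | c≡0 , φ≡0 = cong₂ _+_ (trans (cong (_* u p) (isZeroPoly-sound c x c≡0)) (*-zeroˡ (u p))) (isZero-sound φ x u φ≡0)

  module Normalise (canon : ℤ² → ℤ²) where

    insert : Poly × ℤ² → Form → Form
    insert (c , p) []            = (c , p) ∷ []
    insert (c , p) ((d , q) ∷ φ) = if does (p ≟² q) then (c ⊞ d , q) ∷ φ else (d , q) ∷ insert (c , p) φ

    ⟦insert⟧ : ∀ t φ x u → ⟦ insert t φ ⟧ x u ≡ ⟦ t ∷ φ ⟧ x u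
    ⟦insert⟧ t []                  x u = refl
    ⟦insert⟧ (c , p) ((d , q) ∷ φ) x u with p ≟² q
    ... | yes refl = trans (cong (λ v → v * u p + ⟦ φ ⟧ x u) (eval-⊞ c d x))
                           (regroup (eval c x) (eval d x) (u p) (⟦ φ ⟧ x u))
      where
      regroup : ∀ a b v w → (a + b) * v + w ≡ a * v + (b * v + w)
      regroup = solve-∀
    ... | no _     = trans (cong (eval d x * u q +_) (⟦insert⟧ (c , p) φ x u))
                           (exchange (eval d x * u q) (eval c x * u p) (⟦ φ ⟧ x u))
      where
      exchange : ∀ a b w → a + (b + w) ≡ b + (a + w)
      exchange = solve-∀

    normalise : Form → Form
    normalise = foldr (λ (c , p) → insert (c , canon p)) []

    ⟦normalise⟧ : ∀ φ x u → (∀ p → u (canon p) ≡ u p) → ⟦ normalise φ ⟧ x u ≡ ⟦ φ ⟧ x u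
    ⟦normalise⟧ []            x u u∘canon = refl
    ⟦normalise⟧ ((c , p) ∷ φ) x u u∘canon =
      trans (⟦insert⟧ (c , canon p) (normalise φ) x u)
            (cong₂ (λ v w → eval c x * v + w) (u∘canon p) (⟦normalise⟧ φ x u u∘canon))

    vanishes : ∀ φ → T (isZero (normalise φ)) → ∀ x u → (∀ p → u (canon p) ≡ u p) → ⟦ φ ⟧ x u ≡ 0ℤ
    vanishes φ nf≡0 x u u∘canon = trans (sym (⟦normalise⟧ φ x u u∘canon)) (isZero-sound (normalise φ) x u nf≡0)

module HesitatingWalkCount where

  open import Data.Nat using (ℕ; zero; suc; _+_; _≤_; _<?_; s≤s; z≤n)
  open import Data.Nat.Properties using (+-comm; +-identityʳ; +-cancelʳ-≡; m+1+n≢0; <-irrelevant)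
  import Data.Nat.Properties as ℕ
  open import Data.List using (applyUpTo)
  open import Data.Nat.ListAction using (sum)
  open import Data.Fin using (Fin; zero; suc)
  open import Data.Fin.Properties using (+↔⊎)
  open import Data.Product using (Σ; _×_; _,_; proj₁; proj₂)
  open import Data.Product.Properties using (≡-dec)
  open import Data.Sum using (_⊎_; inj₁; inj₂)
  open import Data.Sum.Function.Propositional using (_⊎-↔_)
  open import Function.Bundles using (_↔_; mk↔ₛ′)
  open import Function.Properties.Inverse using (↔-trans)
  open import Relation.Nullary using (Dec; yes; no; ¬_; Irrelevant; contradiction)
  open import Relation.Binary.Definitions using (DecidableEquality)
  open import Relation.Binary.PropositionalEquality
  open import Axiom.UniquenessOfIdentityProofs using (module Decidable⇒UIP)

  target : Point
  target = (1 , 0)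

  _≟ᴾ_ : DecidableEquality Point
  _≟ᴾ_ = ≡-dec ℕ._≟_ ℕ._≟_

  ≡ᴾ-irrelevant : {p q : Point} → Irrelevant (p ≡ q)
  ≡ᴾ-irrelevant = Decidable⇒UIP.≡-irrelevant _≟ᴾ_

  InW? : (p : Point) → Dec (InW p)
  InW? (a , b) = b <? a

  InW-irrelevant : {p : Point} → Irrelevant (InW p)
  InW-irrelevant = <-irrelevant

  walk-InW : ∀ {n p s} → HWalk n p s → InW p
  walk-InW (done w)       = w
  walk-InW (step w _ _ _) = w

  empty↔ : {A : Set} → ¬ A → Fin 0 ↔ A
  empty↔ ¬a = mk↔ₛ′ (λ ()) (λ a → contradiction a ¬a) (λ a → contradiction a ¬a) (λ ())

  +↔ : {m n : ℕ} {A B : Set} → Fin m ↔ A → Fin n ↔ B → Fin (m + n) ↔ (A ⊎ B)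
  +↔ f g = ↔-trans +↔⊎ (f ⊎-↔ g)

  sum₂ : (Fin 2 → ℕ) → ℕ
  sum₂ f = f zero + f (suc zero)

  sum₂↔ : {f : Fin 2 → ℕ} {A : Fin 2 → Set} → (∀ i → Fin (f i) ↔ A i) → Fin (sum₂ f) ↔ Σ (Fin 2) A
  sum₂↔ f↔ = ↔-trans (+↔ (f↔ zero) (f↔ (suc zero))) (mk↔ₛ′
    (λ { (inj₁ a) → zero , a ; (inj₂ a) → suc zero , a })
    (λ { (zero , a) → inj₁ a ; (suc zero , a) → inj₂ a })
    (λ { (zero , a) → refl ; (suc zero , a) → refl })
    (λ { (inj₁ a) → refl ; (inj₂ a) → refl }))

  sum-applyUpTo↔ : ∀ k {C : ℕ → Set} {c : ℕ → ℕ} → (∀ i → Fin (c i) ↔ C i) → (∀ i → k ≤ i → ¬ C i) →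
                   Fin (sum (applyUpTo c k)) ↔ Σ ℕ C
  sum-applyUpTo↔ zero    c↔C beyond = empty↔ (λ (i , x) → beyond i z≤n x)
  sum-applyUpTo↔ (suc k) c↔C beyond =
    ↔-trans (+↔ (c↔C 0) (sum-applyUpTo↔ k (λ i → c↔C (suc i)) (λ i k≤i → beyond (suc i) (s≤s k≤i))))
            (mk↔ₛ′ (λ { (inj₁ x) → 0 , x ; (inj₂ (i , x)) → suc i , x })
                   (λ { (zero , x) → inj₁ x ; (suc i , x) → inj₂ (i , x) })
                   (λ { (zero , x) → refl ; (suc i , x) → refl })
                   (λ { (inj₁ x) → refl ; (inj₂ (i , x)) → refl }))

  restrict : {P : Set} → Dec P → ℕ → ℕ
  restrict (yes _) k = k
  restrict (no _)  k = 0

  restrict-yes : {P : Set} {k : ℕ} (P? : Dec P) → P → restrict P? k ≡ k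
  restrict-yes (yes _) _ = refl
  restrict-yes (no ¬p) p = contradiction p ¬p

  restrict↔ : {P X : Set} {k : ℕ} (P? : Dec P) → Irrelevant P → (P → Fin k ↔ X) → Fin (restrict P? k) ↔ (P × X)
  restrict↔ (yes p) P-irr k↔X = ↔-trans (k↔X p) (mk↔ₛ′ (p ,_) proj₂ (λ (p′ , x) → cong (_, x) (P-irr p p′)) (λ _ → refl))
  restrict↔ (no ¬p) P-irr k↔X = empty↔ (λ (p , _) → ¬p p)

  below : (Point → ℕ) → Fin 2 → Point → ℕ
  below c zero       (zero  , b)     = 0
  below c zero       (suc a , b)     = c (a , b)
  below c (suc zero) (a     , zero)  = 0
  below c (suc zero) (a     , suc b) = c (a , b)

  ⊕e-injective : ∀ i {q q′} → q ⊕ e i ≡ q′ ⊕ e i → q ≡ q′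
  ⊕e-injective i {a , b} {a′ , b′} eq =
    cong₂ _,_ (+-cancelʳ-≡ _ a a′ (cong proj₁ eq)) (+-cancelʳ-≡ _ b b′ (cong proj₂ eq))

  predecessor↔ : ∀ i {p q₀} → p ≡ q₀ ⊕ e i → {C : Point → Set} → C q₀ ↔ Σ Point (λ q → (p ≡ q ⊕ e i) × C q)
  predecessor↔ i {p} {q₀} p≡q₀⊕eᵢ {C} = mk↔ₛ′ (λ x → q₀ , p≡q₀⊕eᵢ , x)
    (λ (q , p≡q⊕eᵢ , x) → subst C (unique p≡q⊕eᵢ) x)
    (λ (q , p≡q⊕eᵢ , x) → to∘from (unique p≡q⊕eᵢ) p≡q⊕eᵢ x)
    (λ x → cong (λ eq → subst C eq x) (≡ᴾ-irrelevant (unique p≡q₀⊕eᵢ) refl))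
    where
    unique : ∀ {q} → p ≡ q ⊕ e i → q ≡ q₀
    unique p≡q⊕eᵢ = ⊕e-injective i (trans (sym p≡q⊕eᵢ) p≡q₀⊕eᵢ)
    to∘from : ∀ {q} (q≡q₀ : q ≡ q₀) (p≡q⊕eᵢ : p ≡ q ⊕ e i) (x : C q) →
              _≡_ {A = Σ Point (λ q → (p ≡ q ⊕ e i) × C q)} (q₀ , p≡q₀⊕eᵢ , subst C q≡q₀ x) (q , p≡q⊕eᵢ , x)
    to∘from refl p≡q⊕eᵢ x = cong (λ eq → _ , eq , x) (≡ᴾ-irrelevant p≡q₀⊕eᵢ p≡q⊕eᵢ)

  below↔ : ∀ i p {C : Point → Set} {c : Point → ℕ} → (∀ q → Fin (c q) ↔ C q) →
           Fin (below c i p) ↔ Σ Point (λ q → (p ≡ q ⊕ e i) × C q)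
  below↔ zero (zero , b) c↔C = empty↔ (λ ((a′ , _) , eq , _) → m+1+n≢0 a′ (sym (cong proj₁ eq)))
  below↔ zero (suc a , b) c↔C =
    ↔-trans (c↔C (a , b)) (predecessor↔ zero (cong₂ _,_ (+-comm 1 a) (sym (+-identityʳ b))))
  below↔ (suc zero) (a , zero) c↔C = empty↔ (λ ((_ , b′) , eq , _) → m+1+n≢0 b′ (sym (cong proj₂ eq)))
  below↔ (suc zero) (a , suc b) c↔C =
    ↔-trans (c↔C (a , b)) (predecessor↔ (suc zero) (cong₂ _,_ (sym (+-identityʳ a)) (+-comm 1 b)))

  StepPair : Point → (Point → Set) → Set
  StepPair p W = Σ Point λ q → Σ Point λ r → InW q × HPair p q r × W r

  walk-suc↔ : ∀ {n p s} → (InW p × StepPair p (λ r → HWalk n r s)) ↔ HWalk (suc n) p s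
  walk-suc↔ = mk↔ₛ′ (λ (wp , q , r , wq , h , rest) → step wp wq h rest)
                    (λ { (step wp wq h rest) → wp , _ , _ , wq , h , rest })
                    (λ { (step _ _ _ _) → refl })
                    (λ (_ , _ , _ , _ , _ , _) → refl)

  module _ (p : Point) (W : Point → Set) where

    StayUp DownStay UpDown : Set
    StayUp   = Σ (Fin 2) λ i → InW p × W (p ⊕ e i)
    DownStay = Σ (Fin 2) λ i → Σ Point λ q → (p ≡ q ⊕ e i) × (InW q × W q)
    UpDown   = Σ (Fin 2) λ i → InW (p ⊕ e i) × Σ (Fin 2) λ j → Σ Point λ r → (p ⊕ e i ≡ r ⊕ e j) × W r

    stepPair↔ : (StayUp ⊎ DownStay ⊎ UpDown) ↔ StepPair p W
    stepPair↔ = mk↔ₛ′ from to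
      (λ { (_ , _ , _ , stay-up _ _ , _)         → refl
         ; (_ , _ , _ , down-stay _ _ , _)       → refl
         ; (_ , _ , _ , up-down _ _ _ _ _ , _)   → refl })
      (λ { (inj₁ _)                              → refl
         ; (inj₂ (inj₁ (_ , _ , refl , _)))      → refl
         ; (inj₂ (inj₂ _))                       → refl })
      where
      to : StepPair p W → StayUp ⊎ DownStay ⊎ UpDown
      to (_ , _ , wq , stay-up _ i , x)            = inj₁ (i , wq , x)
      to (q , _ , wq , down-stay _ i , x)          = inj₂ (inj₁ (i , q , refl , wq , x))
      to (_ , r , wq , up-down _ _ i j eq , x)     = inj₂ (inj₂ (i , wq , j , r , eq , x))
      from : StayUp ⊎ DownStay ⊎ UpDown → StepPair p W
      from (inj₁ (i , wp , x))                     = p , p ⊕ e i , wp , stay-up p i , x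
      from (inj₂ (inj₁ (i , q , refl , wq , x)))   = q , q , wq , down-stay q i , x
      from (inj₂ (inj₂ (i , w , j , r , eq , x)))  = p ⊕ e i , r , w , up-down r p i j eq , x

  stepCount : (Point → ℕ) → Point → ℕ
  stepCount c p = restrict (InW? p)
    (sum₂ (λ i → c (p ⊕ e i))
     + (sum₂ (λ i → below c i p)
     + sum₂ (λ i → restrict (InW? (p ⊕ e i)) (sum₂ (λ j → below c j (p ⊕ e i))))))

  count : ℕ → Point → ℕ
  count zero    p = restrict (p ≟ᴾ target) 1
  count (suc n) p = stepCount (count n) p

  walks↔ : ∀ n p → Fin (count n p) ↔ HWalk n p target
  walks↔ zero p with p ≟ᴾ target
  ... | yes refl = mk↔ₛ′ (λ _ → done (s≤s z≤n)) (λ _ → zero)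
                         (λ { (done w) → cong done (InW-irrelevant _ w) }) (λ { zero → refl })
  ... | no p≢t   = empty↔ (λ { (done _) → p≢t refl })
  walks↔ (suc n) p = ↔-trans (restrict↔ (InW? p) InW-irrelevant (λ wp →
      ↔-trans (+↔ (sum₂↔ (λ i → ↔-trans (walks↔ n (p ⊕ e i)) (InW×↔ wp)))
                  (+↔ (sum₂↔ (λ i → below↔ i p (λ q → ↔-trans (walks↔ n q) walk↔InW×walk)))
                      (sum₂↔ (λ i → restrict↔ (InW? (p ⊕ e i)) InW-irrelevant (λ _ →
                                      sum₂↔ (λ j → below↔ j (p ⊕ e i) (walks↔ n)))))))
              (stepPair↔ p (λ r → HWalk n r target))))
    walk-suc↔
    where
    InW×↔ : {X : Set} → InW p → X ↔ (InW p × X)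
    InW×↔ wp = mk↔ₛ′ (wp ,_) proj₂ (λ (w , x) → cong (_, x) (InW-irrelevant wp w)) (λ _ → refl)
    walk↔InW×walk : ∀ {q} → HWalk n q target ↔ (InW q × HWalk n q target)
    walk↔InW×walk = mk↔ₛ′ (λ w → walk-InW w , w) proj₂ (λ (w , x) → cong (_, x) (InW-irrelevant _ w)) (λ _ → refl)

  proj₁-e≤1 : ∀ i → proj₁ (e i) ≤ 1
  proj₁-e≤1 zero       = s≤s z≤n
  proj₁-e≤1 (suc zero) = z≤n

  HPair-proj₁≤ : ∀ {p q r} → HPair p q r → proj₁ p ≤ suc (proj₁ r)
  HPair-proj₁≤ (stay-up (a , _) i)        = ℕ.≤-trans (ℕ.m≤m+n a (proj₁ (e i))) (ℕ.n≤1+n _)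
  HPair-proj₁≤ (down-stay (a , _) i)      = ℕ.≤-trans (ℕ.+-monoʳ-≤ a (proj₁-e≤1 i)) (ℕ.≤-reflexive (+-comm a 1))
  HPair-proj₁≤ (up-down (c , _) (a , _) i j eq) =
    ℕ.≤-trans (ℕ.m≤m+n a (proj₁ (e i))) (ℕ.≤-trans (ℕ.≤-reflexive (cong proj₁ eq))
              (ℕ.≤-trans (ℕ.+-monoʳ-≤ c (proj₁-e≤1 j)) (ℕ.≤-reflexive (+-comm c 1))))

  walk-proj₁≤ : ∀ {n p s} → HWalk n p s → proj₁ p ≤ n + proj₁ s
  walk-proj₁≤ (done _)          = ℕ.≤-refl
  walk-proj₁≤ (step _ _ h rest) = ℕ.≤-trans (HPair-proj₁≤ h) (s≤s (walk-proj₁≤ rest))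

module ReflectionPrinciple where

  open import Data.Nat using (ℕ; suc)
  open import Data.Integer using (ℤ; +_; 0ℤ; 1ℤ; -1ℤ; _+_; _*_; -_; _-_)
  open import Data.Integer.Tactic.RingSolver using (solve-∀)
  open import Data.Product using (_×_; _,_)
  open import Data.List using (List; []; _∷_; concatMap)
  open import Relation.Binary.PropositionalEquality
  open IntegerSums
  open FreeWalks

  -- The walls of W₂ are the lines a = b and b = -1.  The affine reflections in them, swapℤ² and
  -- reflectWall, generate a dihedral group of order 12; its orbit of (1,0), signed by the parity of
  -- the group elements, consists of the pairs (q, swapℤ² q) for the six points below.
  reflectWall : ℤ² → ℤ²
  reflectWall (a , b) = (a + b + 1 , - b - 2)

  halfOrbit : List (ℤ × ℤ²)
  halfOrbit = (1 , (1 , 0)) ∷ (-1 , (2 , -2)) ∷ (-1 , (1 , -4)) ∷ (-1 , (-2 , -3)) ∷ (-1 , (-4 , 0)) ∷ (-1 , (-3 , 2)) ∷ []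

  orbit : List (ℤ × ℤ²)
  orbit = concatMap (λ (c , q) → (c , q) ∷ (- c , swapℤ² q) ∷ []) halfOrbit

  signedWalks : ℕ → ℤ² → ℤ
  signedWalks n p = ∑ orbit (λ (c , q) → c * freeWalks n (p ⊖ q))

  signedWalks-suc : ∀ n p → signedWalks (suc n) p ≡ ∑ netSteps (λ s → signedWalks n (p ⊖ s))
  signedWalks-suc n p = begin
      ∑ orbit (λ (c , q) → c * ∑ netSteps (λ s → freeWalks n ((p ⊖ q) ⊖ s)))
    ≡⟨ ∑-cong orbit (λ (c , q) → sym (∑-* netSteps c (λ s → freeWalks n ((p ⊖ q) ⊖ s)))) ⟩
      ∑ orbit (λ (c , q) → ∑ netSteps (λ s → c * freeWalks n ((p ⊖ q) ⊖ s)))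
    ≡⟨ ∑-comm orbit netSteps (λ (c , q) s → c * freeWalks n ((p ⊖ q) ⊖ s)) ⟩
      ∑ netSteps (λ s → ∑ orbit (λ (c , q) → c * freeWalks n ((p ⊖ q) ⊖ s)))
    ≡⟨ ∑-cong netSteps (λ s → ∑-cong orbit (λ (c , q) → cong (λ x → c * freeWalks n x) (⊖-comm p q s))) ⟩
      ∑ netSteps (λ s → ∑ orbit (λ (c , q) → c * freeWalks n ((p ⊖ s) ⊖ q)))
    ∎
    where open ≡-Reasoning

  signedWalks-swap : ∀ n p → signedWalks n (swapℤ² p) ≡ - signedWalks n p
  signedWalks-swap n p = begin
      ∑ orbit (λ (c , q) → c * freeWalks n (swapℤ² p ⊖ q))
    ≡⟨ ∑-concatMap pair halfOrbit (λ (c , q) → c * freeWalks n (swapℤ² p ⊖ q)) ⟩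
      ∑ halfOrbit (λ (c , q) → c * U (swapℤ² (p ⊖ swapℤ² q)) + (- c * U (swapℤ² (p ⊖ q)) + 0ℤ))
    ≡⟨ ∑-cong halfOrbit (λ (c , q) → cong₂ (λ x y → c * x + (- c * y + 0ℤ))
                                          (freeWalks-swap n (p ⊖ swapℤ² q)) (freeWalks-swap n (p ⊖ q))) ⟩
      ∑ halfOrbit (λ (c , q) → c * U (p ⊖ swapℤ² q) + (- c * U (p ⊖ q) + 0ℤ))
    ≡⟨ ∑-cong halfOrbit (λ (c , q) → exchange c (U (p ⊖ swapℤ² q)) (U (p ⊖ q))) ⟩
      ∑ halfOrbit (λ (c , q) → - (c * U (p ⊖ q) + (- c * U (p ⊖ swapℤ² q) + 0ℤ)))
    ≡⟨ ∑-neg halfOrbit (λ (c , q) → c * U (p ⊖ q) + (- c * U (p ⊖ swapℤ² q) + 0ℤ)) ⟩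
      - ∑ halfOrbit (λ (c , q) → c * U (p ⊖ q) + (- c * U (p ⊖ swapℤ² q) + 0ℤ))
    ≡⟨ cong -_ (sym (∑-concatMap pair halfOrbit (λ (c , q) → c * freeWalks n (p ⊖ q)))) ⟩
      - signedWalks n p
    ∎
    where
    open ≡-Reasoning
    U : ℤ² → ℤ
    U = freeWalks n
    pair : ℤ × ℤ² → List (ℤ × ℤ²)
    pair (c , q) = (c , q) ∷ (- c , swapℤ² q) ∷ []
    exchange : ∀ c x y → c * x + (- c * y + 0ℤ) ≡ - (c * y + (- c * x + 0ℤ))
    exchange = solve-∀

  signedWalks-reflectWall : ∀ n p → signedWalks n (reflectWall p) ≡ - signedWalks n p
  signedWalks-reflectWall n p = begin
      ∑ orbit (λ (c , q) → c * freeWalks n (reflectWall p ⊖ q))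
    ≡⟨ ∑-cong orbit (λ (c , q) → cong (c *_) (trans (cong (freeWalks n) (reflectWall-⊖ p q))
                                                    (freeWalks-reflect n (p ⊖ reflectWall q)))) ⟩
      ∑ orbit (λ (c , q) → c * U (reflectWall q))
    ≡⟨ permute (U (1 , 0)) (U (0 , 1)) (U (2 , -2)) (U (-2 , 2)) (U (1 , -4)) (U (-4 , 1))
               (U (-2 , -3)) (U (-3 , -2)) (U (-4 , 0)) (U (0 , -4)) (U (-3 , 2)) (U (2 , -3)) ⟩
      - signedWalks n p
    ∎
    where
    open ≡-Reasoning
    U : ℤ² → ℤ
    U q = freeWalks n (p ⊖ q)
    reflectWall-⊖ : ∀ p q → reflectWall p ⊖ q ≡ reflectℤ² (p ⊖ reflectWall q)
    reflectWall-⊖ (a , b) (c , d) = cong₂ _,_ (first a b c d) (second b d)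
      where
      first : ∀ a b c d → a + b + 1ℤ - c ≡ (a - (c + d + 1ℤ)) + (b - (- d - + 2))
      first = solve-∀
      second : ∀ b d → - b - + 2 - d ≡ - (b - (- d - + 2))
      second = solve-∀
    -- reflectWall permutes the orbit, reversing all signs
    permute : ∀ x₁ x₂ x₃ x₄ x₅ x₆ x₇ x₈ x₉ x₁₀ x₁₁ x₁₂ →
        1ℤ * x₃ + (-1ℤ * x₁₂ + (-1ℤ * x₁ + (1ℤ * x₅ + (-1ℤ * x₄ + (1ℤ * x₇
          + (-1ℤ * x₆ + (1ℤ * x₉ + (-1ℤ * x₈ + (1ℤ * x₁₁ + (-1ℤ * x₁₀ + (1ℤ * x₂ + 0ℤ)))))))))))
      ≡ - (1ℤ * x₁ + (-1ℤ * x₂ + (-1ℤ * x₃ + (1ℤ * x₄ + (-1ℤ * x₅ + (1ℤ * x₆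
          + (-1ℤ * x₇ + (1ℤ * x₈ + (-1ℤ * x₉ + (1ℤ * x₁₀ + (-1ℤ * x₁₁ + (1ℤ * x₁₂ + 0ℤ))))))))))))
    permute = solve-∀

  signedWalks-diagonal : ∀ n x → signedWalks n (x , x) ≡ 0ℤ
  signedWalks-diagonal n x = i≡-i⇒i≡0 _ (signedWalks-swap n (x , x))

  signedWalks-wall : ∀ n x → signedWalks n (x , -1) ≡ 0ℤ
  signedWalks-wall n x = i≡-i⇒i≡0 _ (trans (cong (λ y → signedWalks n (y , -1)) (sym (cancel x)))
                                             (signedWalks-reflectWall n (x , -1)))
    where
    cancel : ∀ x → x + -1ℤ + 1ℤ ≡ x
    cancel = solve-∀

module CountIsSignedWalks where

  open import Data.Nat using (ℕ; zero; suc; _≤_; s≤s; z≤n)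
  import Data.Nat as ℕ
  open import Data.Nat.Properties using (+-comm; n≮n; m≤n⇒m<n∨m≡n; m≤n⇒m≤1+n; ≤-pred; n≤1+n; ≤-trans)
  import Data.Nat.Properties as ℕ
  open import Data.Integer using (ℤ; +_; 0ℤ; 1ℤ; -1ℤ; _+_; _-_; -_; _*_)
  open import Data.Integer.Properties using (+-identityʳ; +-inverseˡ; *-zeroʳ)
  open import Data.Integer.Tactic.RingSolver using (solve-∀)
  open import Data.Fin using (zero; suc)
  open import Data.Product using (_×_; _,_)
  open import Data.Sum using (inj₁; inj₂)
  open import Data.List.Relation.Unary.All as All using ([]; _∷_)
  open import Relation.Nullary using (Dec; yes; no; ¬_; contradiction)
  open import Relation.Binary.PropositionalEquality
  open IntegerSums
  open FreeWalks
  open ReflectionPrinciple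
  open HesitatingWalkCount

  count-outside : ∀ n p → ¬ InW p → count n p ≡ 0
  count-outside zero p p∉W with p ≟ᴾ target
  ... | yes refl = contradiction (s≤s z≤n) p∉W
  ... | no _     = refl
  count-outside (suc n) p p∉W with InW? p
  ... | yes p∈W = contradiction p∈W p∉W
  ... | no _    = refl

  CountIsSigned : ℕ → Set
  CountIsSigned n = ∀ a b → b ≤ a → + count n (a , b) ≡ signedWalks n (+ a , + b)

  count≡signedWalks-zero : CountIsSigned 0
  count≡signedWalks-zero a b b≤a with (a , b) ≟ᴾ target
  ... | yes refl = refl
  ... | no p≢t   = sym (∑-zero orbit (All.map (λ {t} → off t)
          ( (λ { refl → p≢t refl }) ∷ (λ { refl → n≮n 0 b≤a }) ∷ (λ ()) ∷ (λ ()) ∷ (λ ()) ∷ (λ ())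
          ∷ (λ ()) ∷ (λ ()) ∷ (λ ()) ∷ (λ ()) ∷ (λ ()) ∷ (λ ()) ∷ [])))
    where
    off : ∀ ((c , q) : ℤ × ℤ²) → (+ a , + b) ≢ q → c * freeWalks 0 ((+ a , + b) ⊖ q) ≡ 0ℤ
    off (c , q) p≢q with ((+ a , + b) ⊖ q) ≟² origin
    ... | yes p⊖q≡o = contradiction (⊖≡origin p⊖q≡o) p≢q
    ... | no _      = *-zeroʳ c

  module StepCase (n : ℕ) (ih : CountIsSigned n) (a b : ℕ) (b≤a : b ≤ a) where

    F : ℤ² → ℤ
    F = signedWalks n

    p : Point
    p = (suc a , b)

    P : ℤ²
    P = (+ suc a , + b)

    +suc : ∀ x → + (x ℕ.+ 1) ≡ + suc x
    +suc x = cong +_ (+-comm x 1)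

    ⊕e₀ : ∀ {x y} → (x , y) ⊕ e zero ≡ (suc x , y)
    ⊕e₀ {x} {y} = cong₂ _,_ (+-comm x 1) (ℕ.+-identityʳ y)

    ⊕e₁ : ∀ {x y} → (x , y) ⊕ e (suc zero) ≡ (x , suc y)
    ⊕e₁ {x} {y} = cong₂ _,_ (ℕ.+-identityʳ x) (+-comm y 1)

    centre : F (P ⊖ origin) ≡ F P
    centre = cong F (cong₂ _,_ (+-identityʳ (+ suc a)) (+-identityʳ (+ b)))

    stayUp : + sum₂ (λ i → count n (p ⊕ e i)) ≡ F (P ⊖ (-1ℤ , 0ℤ)) + F (P ⊖ (0ℤ , -1ℤ))
    stayUp = cong₂ _+_
      (ih (suc a ℕ.+ 1) (b ℕ.+ 0) (ℕ.+-mono-≤ (m≤n⇒m≤1+n b≤a) z≤n))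
      (ih (suc a ℕ.+ 0) (b ℕ.+ 1)
          (subst₂ _≤_ (+-comm 1 b) (sym (ℕ.+-identityʳ (suc a))) (s≤s b≤a)))

    downStay : + sum₂ (λ i → below (count n) i p) ≡ F (P ⊖ (1ℤ , 0ℤ)) + F (P ⊖ (0ℤ , 1ℤ))
    downStay = cong₂ _+_ (trans (ih a b b≤a) (cong (λ y → F (+ a , y)) (cong +_ (sym (ℕ.+-identityʳ b)))))
                         (down₁ b b≤a)
      where
      down₁ : ∀ b → b ≤ a → + below (count n) (suc zero) (suc a , b) ≡ F ((+ suc a , + b) ⊖ (0ℤ , 1ℤ))
      down₁ zero    _     = sym (signedWalks-wall n (+ suc a - 0ℤ))
      down₁ (suc b) 1+b≤a = trans (ih (suc a) b (m≤n⇒m≤1+n (≤-trans (n≤1+n b) 1+b≤a)))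
                                  (cong (λ x → F (x , + b)) (cong +_ (sym (ℕ.+-identityʳ (suc a)))))

    upDownFrom : Point → ℕ
    upDownFrom q = restrict (InW? q) (sum₂ (λ j → below (count n) j q))

    upDown₀ : + upDownFrom (p ⊕ e zero) ≡ F (P ⊖ origin) + F (P ⊖ (-1ℤ , 1ℤ))
    upDown₀ = begin
        + upDownFrom (p ⊕ e zero)
      ≡⟨ cong (λ q → + upDownFrom q) (⊕e₀ {suc a} {b}) ⟩
        + upDownFrom (suc (suc a) , b)
      ≡⟨ cong +_ (restrict-yes (InW? (suc (suc a) , b)) (s≤s (m≤n⇒m≤1+n b≤a))) ⟩
        + count n (suc a , b) + + below (count n) (suc zero) (suc (suc a) , b)
      ≡⟨ cong₂ _+_ (trans (ih (suc a) b (m≤n⇒m≤1+n b≤a)) (sym centre)) (up₀down₁ b b≤a) ⟩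
        F (P ⊖ origin) + F (P ⊖ (-1ℤ , 1ℤ))
      ∎
      where
      open ≡-Reasoning
      up₀down₁ : ∀ b → b ≤ a → + below (count n) (suc zero) (suc (suc a) , b) ≡ F ((+ suc a , + b) ⊖ (-1ℤ , 1ℤ))
      up₀down₁ zero    _     = sym (signedWalks-wall n (+ suc a - -1ℤ))
      up₀down₁ (suc b) 1+b≤a = trans (ih (suc (suc a)) b (m≤n⇒m≤1+n (m≤n⇒m≤1+n (≤-trans (n≤1+n b) 1+b≤a))))
                                      (cong (λ x → F (x , + b)) (sym (+suc (suc a))))

    upDown₁ : + upDownFrom (p ⊕ e (suc zero)) ≡ F (P ⊖ (1ℤ , -1ℤ)) + F (P ⊖ origin)
    upDown₁ = trans (cong (λ q → + upDownFrom q) (⊕e₁ {suc a} {b})) (byCases (InW? (suc a , suc b)))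
      where
      byCases : (w : Dec (InW (suc a , suc b))) →
                + restrict w (sum₂ (λ j → below (count n) j (suc a , suc b))) ≡ F (P ⊖ (1ℤ , -1ℤ)) + F (P ⊖ origin)
      byCases (yes 2+b≤1+a) =
        cong₂ _+_ (trans (ih a (suc b) (≤-pred 2+b≤1+a)) (cong (λ y → F (+ a , y)) (sym (+suc b))))
                  (trans (ih (suc a) b (m≤n⇒m≤1+n b≤a)) (sym centre))
      -- When b = a the intermediate point (a + 1 , a + 1) is outside W₂; the two terms that are
      -- missing on the left cancel by antisymmetry of signedWalks.
      byCases (no b≮a) with m≤n⇒m<n∨m≡n b≤a
      ... | inj₁ b<a  = contradiction (s≤s b<a) b≮a
      ... | inj₂ refl = sym (begin
          F (+ b , + b - -1ℤ) + F (P ⊖ origin)   ≡⟨ cong₂ _+_ (cong (λ y → F (+ b , y)) (+suc b)) centre ⟩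
          F (swapℤ² P) + F P                      ≡⟨ cong (_+ F P) (signedWalks-swap n P) ⟩
          - F P + F P                             ≡⟨ +-inverseˡ (F P) ⟩
          0ℤ                                      ∎)
        where open ≡-Reasoning

    stepCount≡signedWalks : + stepCount (count n) p ≡ signedWalks (suc n) P
    stepCount≡signedWalks = begin
        + stepCount (count n) p
      ≡⟨ cong +_ (restrict-yes (InW? p) (s≤s b≤a)) ⟩
        + (sum₂ (λ i → count n (p ⊕ e i)) ℕ.+ (sum₂ (λ i → below (count n) i p)
            ℕ.+ (upDownFrom (p ⊕ e zero) ℕ.+ upDownFrom (p ⊕ e (suc zero)))))
      ≡⟨ cong₂ _+_ stayUp (cong₂ _+_ downStay (cong₂ _+_ upDown₀ upDown₁)) ⟩
        (F (P ⊖ (-1ℤ , 0ℤ)) + F (P ⊖ (0ℤ , -1ℤ))) + ((F (P ⊖ (1ℤ , 0ℤ)) + F (P ⊖ (0ℤ , 1ℤ)))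
          + ((F (P ⊖ origin) + F (P ⊖ (-1ℤ , 1ℤ))) + (F (P ⊖ (1ℤ , -1ℤ)) + F (P ⊖ origin))))
      ≡⟨ rearrange (F (P ⊖ (1ℤ , 0ℤ))) (F (P ⊖ (0ℤ , 1ℤ))) (F (P ⊖ (-1ℤ , 0ℤ))) (F (P ⊖ (0ℤ , -1ℤ)))
                   (F (P ⊖ origin)) (F (P ⊖ (1ℤ , -1ℤ))) (F (P ⊖ (-1ℤ , 1ℤ))) ⟩
        ∑ netSteps (λ s → F (P ⊖ s))
      ≡⟨ sym (signedWalks-suc n P) ⟩
        signedWalks (suc n) P
      ∎
      where
      open ≡-Reasoning
      rearrange : ∀ x₁ x₂ x₃ x₄ x₀ x₅ x₆ →
        (x₃ + x₄) + ((x₁ + x₂) + ((x₀ + x₆) + (x₅ + x₀)))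
        ≡ x₁ + (x₂ + (x₃ + (x₄ + (x₀ + (x₀ + (x₅ + (x₆ + 0ℤ)))))))
      rearrange = solve-∀

  count≡signedWalks : ∀ n → CountIsSigned n
  count≡signedWalks zero = count≡signedWalks-zero
  count≡signedWalks (suc n) a b b≤a with m≤n⇒m<n∨m≡n b≤a
  ... | inj₂ refl = trans (cong +_ (count-outside (suc n) (a , a) (n≮n a))) (sym (signedWalks-diagonal (suc n) (+ a)))
  count≡signedWalks (suc n) (suc a) b _ | inj₁ (s≤s b≤a) = StepCase.stepCount≡signedWalks n (count≡signedWalks n) a b b≤a

module Telescoping where

  open import Data.Nat using (ℕ; suc; s≤s; z≤n)
  import Data.Nat as ℕ
  import Data.Nat.Properties as ℕ
  open import Data.Integer using (ℤ; +_; 0ℤ; 1ℤ; _+_; _*_; -_; _-_; _≤_; _<_; +<+; +≤+; -≤+)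
  open import Data.Integer.Properties using (+-identityʳ; +-mono-<-≤; neg-mono-≤)
  open import Data.Integer.Tactic.RingSolver using (solve-∀)
  open import Data.Product using (_×_; _,_)
  open import Data.List using (List; []; _∷_; upTo)
  open import Data.List.Relation.Unary.All as All using ([]; _∷_)
  open import Relation.Binary.PropositionalEquality using (_≡_; sym; trans; cong; cong₂; subst; module ≡-Reasoning)
  open IntegerSums
  open FreeWalks
  open ReflectionPrinciple

  -- The orbit regrouped into the pairs (c , q), (-c , q ⊖ (k , 0)), which telescope along the line b = 0.
  telescopingPairs : List (ℤ × ℤ² × ℕ)
  telescopingPairs = (1 , (1 , 0) , 5) ∷ (-1 , (0 , 1) , 4) ∷ (-1 , (2 , -2) , 5)
                   ∷ (1 , (-2 , 2) , 1) ∷ (-1 , (1 , -4) , 1) ∷ (1 , (2 , -3) , 4) ∷ []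

  ∑-orbit-telescopingPairs : ∀ (f : ℤ × ℤ² → ℤ) →
    ∑ orbit f ≡ ∑ telescopingPairs (λ (c , q , k) → f (c , q) + f (- c , q ⊖ (+ k , 0ℤ)))
  ∑-orbit-telescopingPairs f =
    permute (f (1 , (1 , 0))) (f (-1 , (0 , 1))) (f (-1 , (2 , -2))) (f (1 , (-2 , 2))) (f (-1 , (1 , -4)))
            (f (1 , (-4 , 1))) (f (-1 , (-2 , -3))) (f (1 , (-3 , -2))) (f (-1 , (-4 , 0))) (f (1 , (0 , -4)))
            (f (-1 , (-3 , 2))) (f (1 , (2 , -3)))
    where
    permute : ∀ x₁ x₂ x₃ x₄ x₅ x₆ x₇ x₈ x₉ x₁₀ x₁₁ x₁₂ →
      x₁ + (x₂ + (x₃ + (x₄ + (x₅ + (x₆ + (x₇ + (x₈ + (x₉ + (x₁₀ + (x₁₁ + (x₁₂ + 0ℤ)))))))))))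
      ≡ (x₁ + x₉) + ((x₂ + x₆) + ((x₃ + x₈) + ((x₄ + x₁₁) + ((x₅ + x₁₀) + ((x₁₂ + x₇) + 0ℤ)))))
    permute = solve-∀

  module _ (n : ℕ) where

    onAxis : ℤ² → ℕ → ℤ
    onAxis q i = freeWalks n ((+ i , 0ℤ) ⊖ q)

    boundarySum : ℤ
    boundarySum = ∑ telescopingPairs (λ (c , q , k) → c * ∑ (upTo k) (onAxis q))

    N : ℕ
    N = suc (suc n)

    onAxis-vanishes : ∀ q → height q ≤ 1ℤ → ∀ j → onAxis q (N ℕ.+ j) ≡ 0ℤ
    onAxis-vanishes q hq≤1 j = freeWalks-support n _
      (subst (+ n <_) (sym (height-⊖ (+ (N ℕ.+ j) , 0ℤ) q)) (+-mono-<-≤ (+<+ N≤N+j+0) (neg-mono-≤ hq≤1)))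
      where
      N≤N+j+0 : N ℕ.≤ N ℕ.+ j ℕ.+ 0
      N≤N+j+0 = ℕ.≤-trans (ℕ.m≤m+n N j) (ℕ.m≤m+n (N ℕ.+ j) 0)

    telescoped : ∀ q k → height q ≤ 1ℤ → ∑ (upTo N) (λ i → onAxis q i - onAxis q (i ℕ.+ k)) ≡ ∑ (upTo k) (onAxis q)
    telescoped q k hq≤1 = begin
        ∑ (upTo N) (λ i → onAxis q i - onAxis q (i ℕ.+ k))
      ≡⟨ ∑-telescope (onAxis q) k N ⟩
        ∑ (upTo k) (onAxis q) - ∑ (upTo k) (λ j → onAxis q (N ℕ.+ j))
      ≡⟨ cong (_-_ (∑ (upTo k) (onAxis q))) (∑-zero (upTo k) (All.universal (onAxis-vanishes q hq≤1) (upTo k))) ⟩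
        ∑ (upTo k) (onAxis q) - 0ℤ
      ≡⟨ +-identityʳ _ ⟩
        ∑ (upTo k) (onAxis q)
      ∎
      where open ≡-Reasoning

    onAxis-pair : ∀ c q k i → c * onAxis q i + - c * freeWalks n ((+ i , 0ℤ) ⊖ (q ⊖ (+ k , 0ℤ)))
                              ≡ c * (onAxis q i - onAxis q (i ℕ.+ k))
    onAxis-pair c (x , y) k i =
      trans (cong (λ p → c * onAxis (x , y) i + - c * freeWalks n p)
                  (cong₂ _,_ (shift (+ i) (+ k) x) (unshift y)))
            (distrib c (onAxis (x , y) i) (onAxis (x , y) (i ℕ.+ k)))
      where
      shift : ∀ i k x → i - (x - k) ≡ (i + k) - x
      shift = solve-∀
      unshift : ∀ y → 0ℤ - (y - 0ℤ) ≡ 0ℤ - y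
      unshift = solve-∀
      distrib : ∀ c u v → c * u + - c * v ≡ c * (u - v)
      distrib = solve-∀

    ∑-signedWalks-axis : ∑ (upTo N) (λ i → signedWalks n (+ i , 0ℤ)) ≡ boundarySum
    ∑-signedWalks-axis = begin
        ∑ (upTo N) (λ i → signedWalks n (+ i , 0ℤ))
      ≡⟨ ∑-cong (upTo N) (λ i → trans (∑-orbit-telescopingPairs (λ (c , q) → c * freeWalks n ((+ i , 0ℤ) ⊖ q)))
                                      (∑-cong telescopingPairs (λ (c , q , k) → onAxis-pair c q k i))) ⟩
        ∑ (upTo N) (λ i → ∑ telescopingPairs (λ (c , q , k) → c * (onAxis q i - onAxis q (i ℕ.+ k))))
      ≡⟨ ∑-comm (upTo N) telescopingPairs (λ i (c , q , k) → c * (onAxis q i - onAxis q (i ℕ.+ k))) ⟩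
        ∑ telescopingPairs (λ (c , q , k) → ∑ (upTo N) (λ i → c * (onAxis q i - onAxis q (i ℕ.+ k))))
      ≡⟨ ∑-cong telescopingPairs (λ (c , q , k) → ∑-* (upTo N) c (λ i → onAxis q i - onAxis q (i ℕ.+ k))) ⟩
        ∑ telescopingPairs (λ (c , q , k) → c * ∑ (upTo N) (λ i → onAxis q i - onAxis q (i ℕ.+ k)))
      ≡⟨ ∑-cong-All telescopingPairs (All.map (λ { {c , q , k} hq≤1 → cong (c *_) (telescoped q k hq≤1) })
                                              (+≤+ (s≤s z≤n) ∷ +≤+ (s≤s z≤n) ∷ +≤+ z≤n ∷ +≤+ z≤n ∷ -≤+ ∷ -≤+ ∷ [])) ⟩
        boundarySum
      ∎
      where open ≡-Reasoning

module Canonical where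

  open import Data.Nat using (ℕ; zero; suc)
  open import Data.Integer using (ℤ; _<?_; _≟_)
  open import Data.Bool using (Bool; true; false; if_then_else_; _∧_; _∨_)
  open import Data.Product using (_,_)
  open import Data.List using (List; []; _∷_; _++_; foldr)
  open import Data.List.Relation.Unary.All as All using (All; []; _∷_)
  open import Data.List.Relation.Unary.All.Properties using (++⁺)
  open import Relation.Nullary using (does)
  open import Relation.Binary.PropositionalEquality using (_≡_; refl; trans)
  open FreeWalks

  zigzag : ℕ → (ℤ² → ℤ²) → (ℤ² → ℤ²) → ℤ² → List ℤ²
  zigzag zero    σ τ p = []
  zigzag (suc k) σ τ p = σ p ∷ zigzag k τ σ (σ p)

  zigzag-invariant : ∀ {f : ℤ² → ℤ} {σ τ} → (∀ p → f (σ p) ≡ f p) → (∀ p → f (τ p) ≡ f p) →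
                     ∀ k p → All (λ q → f q ≡ f p) (zigzag k σ τ p)
  zigzag-invariant f∘σ f∘τ zero    p = []
  zigzag-invariant {σ = σ} f∘σ f∘τ (suc k) p =
    f∘σ p ∷ All.map (λ fq≡fσp → trans fq≡fσp (f∘σ p)) (zigzag-invariant f∘τ f∘σ k (σ p))

  -- With p itself, these are the images of p under the dihedral group of order 12 generated by the
  -- two reflections: all alternating words in them.
  symmetricImages : ℤ² → List ℤ²
  symmetricImages p = zigzag 6 swapℤ² reflectℤ² p ++ zigzag 5 reflectℤ² swapℤ² p

  lexLess : ℤ² → ℤ² → Bool
  lexLess (a , b) (c , d) = does (a <? c) ∨ (does (a ≟ c) ∧ does (b <? d))

  lexMin : ℤ² → ℤ² → ℤ²
  lexMin p q = if lexLess p q then p else q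

  foldr-lexMin : ∀ (P : ℤ² → Set) {p qs} → P p → All P qs → P (foldr lexMin p qs)
  foldr-lexMin P Pp []         = Pp
  foldr-lexMin P {p} {q ∷ qs} Pp (Pq ∷ Pqs) = choose (lexLess q (foldr lexMin p qs)) Pq (foldr-lexMin P Pp Pqs)
    where
    choose : ∀ b {x y} → P x → P y → P (if b then x else y)
    choose true  Px Py = Px
    choose false Px Py = Py

  -- The lexicographically least point of the orbit, so that equivalent points get the same representative.
  canonical : ℤ² → ℤ²
  canonical p = foldr lexMin p (symmetricImages p)

  freeWalks-canonical : ∀ n p → freeWalks n (canonical p) ≡ freeWalks n p
  freeWalks-canonical n p = foldr-lexMin (λ q → freeWalks n q ≡ freeWalks n p) {p} {symmetricImages p} refl
    (++⁺ (zigzag-invariant (freeWalks-swap n) (freeWalks-reflect n) 6 p)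
         (zigzag-invariant (freeWalks-reflect n) (freeWalks-swap n) 5 p))

module Recurrence where

  open import Data.Nat using (ℕ; zero; suc)
  import Data.Nat as ℕ
  open import Data.Integer using (ℤ; +_; 0ℤ; 1ℤ; _+_; _*_; -_; _-_)
  open import Data.Integer.Properties using (*-zeroʳ; +-identityʳ)
  open import Data.Integer.Tactic.RingSolver using (solve-∀)
  open import Data.Fin using (Fin; zero; suc)
  open import Data.Product using (_×_; _,_; proj₁; proj₂)
  open import Data.List using (List; []; _∷_; [_]; _++_; map; concatMap; upTo)
  open import Data.List.Relation.Unary.All as All using ()
  open import Relation.Binary.PropositionalEquality using (_≡_; refl; sym; trans; cong; cong₂; module ≡-Reasoning)
  open IntegerSums
  open FreeWalks
  open Telescoping
  open LinearForms
  open Canonical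

  walkForm : ℕ → ℤ² → Form
  walkForm zero    d = ([ 1ℤ ] , d) ∷ []
  walkForm (suc k) d = concatMap (λ s → walkForm k (d ⊖ s)) netSteps

  ⟦walkForm⟧ : ∀ k d n → ⟦ walkForm k d ⟧ (+ n) (freeWalks n) ≡ freeWalks (k ℕ.+ n) d
  ⟦walkForm⟧ zero    d n = unit (+ n) (freeWalks n d)
    where
    unit : ∀ x u → (1ℤ + x * 0ℤ) * u + 0ℤ ≡ u
    unit = solve-∀
  ⟦walkForm⟧ (suc k) d n = trans (∑-concatMap (λ s → walkForm k (d ⊖ s)) netSteps _)
                                 (∑-cong netSteps (λ s → ⟦walkForm⟧ k (d ⊖ s) n))

  axisForm : ℕ → ℤ² → ℕ → Form
  axisForm k q m = concatMap (λ j → walkForm k ((+ j , 0ℤ) ⊖ q)) (upTo m)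

  boundaryForm : ℕ → Form
  boundaryForm k = concatMap (λ (c , q , m) → scale [ c ] (axisForm k q m)) telescopingPairs

  ⟦boundaryForm⟧ : ∀ k n → ⟦ boundaryForm k ⟧ (+ n) (freeWalks n) ≡ boundarySum (k ℕ.+ n)
  ⟦boundaryForm⟧ k n =
    trans (∑-concatMap (λ (c , q , m) → scale [ c ] (axisForm k q m)) telescopingPairs term)
          (∑-cong telescopingPairs (λ (c , q , m) →
            trans (⟦scale⟧ [ c ] (axisForm k q m) (+ n) (freeWalks n))
                  (cong₂ _*_ (eval-constant c (+ n))
                             (trans (∑-concatMap (λ j → walkForm k ((+ j , 0ℤ) ⊖ q)) (upTo m) term)
                                    (∑-cong (upTo m) (λ j → ⟦walkForm⟧ k ((+ j , 0ℤ) ⊖ q) n))))))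
    where
    term : Poly × ℤ² → ℤ
    term (c , p) = eval c (+ n) * freeWalks n p

  coordinate : Fin 2 → ℤ² → ℤ
  coordinate zero       = proj₁
  coordinate (suc zero) = proj₂

  coordinate-⊖ : ∀ i p s → coordinate i (p ⊖ s) ≡ coordinate i p - coordinate i s
  coordinate-⊖ zero       p s = refl
  coordinate-⊖ (suc zero) p s = refl

  -- The relation Euler.freeWalks-euler for π = coordinate i at the point d, with n as the variable.
  eulerForm : Fin 2 → ℤ² → Form
  eulerForm i d = map (λ s → (coordinate i d - coordinate i s ∷ - coordinate i s ∷ []) , d ⊖ s) netSteps

  ⟦eulerForm⟧ : ∀ i d n → ⟦ eulerForm i d ⟧ (+ n) (freeWalks n) ≡ 0ℤ
  ⟦eulerForm⟧ i d n =
    trans (∑-map (λ s → (π d - π s ∷ - π s ∷ []) , d ⊖ s) netSteps (λ (c , p) → eval c (+ n) * freeWalks n p))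
          (trans (∑-cong netSteps (λ s → regroup (π d) (π s) (+ n) (freeWalks n (d ⊖ s))))
                 (Euler.freeWalks-euler π (coordinate-⊖ i) n d))
    where
    π : ℤ² → ℤ
    π = coordinate i
    regroup : ∀ a b x u → ((a - b) + x * (- b + x * 0ℤ)) * u ≡ (a - (1ℤ + x) * b) * u
    regroup = solve-∀

  -- Multipliers of the Euler relations, found by linear algebra; vanishes below only checks them.
  eulerCertificate : List (Fin 2 × ℤ² × Poly)
  eulerCertificate =
      (zero , (-4 , 1) , 22 ∷ [])
    ∷ (suc zero , (-4 , 1) , 134 ∷ 6 ∷ [])
    ∷ (zero , (-3 , 1) , 46 ∷ 6 ∷ [])
    ∷ (zero , (-4 , -2) , -4 ∷ [])
    ∷ (zero , (-4 , -1) , 16 ∷ 2 ∷ [])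
    ∷ (zero , (-4 , 0) , -28 ∷ -18 ∷ [])
    ∷ (zero , (-3 , 0) , -16 ∷ -16 ∷ [])
    ∷ (zero , (-2 , 0) , 32 ∷ 12 ∷ [])
    ∷ (suc zero , (-4 , -2) , 10 ∷ 2 ∷ [])
    ∷ (suc zero , (-4 , -1) , -70 ∷ -14 ∷ [])
    ∷ (zero , (-1 , 0) , -56 ∷ -16 ∷ [])
    ∷ (zero , (-3 , -2) , 52 ∷ 16 ∷ [])
    ∷ (zero , (-4 , 2) , 15 ∷ 15 ∷ [])
    ∷ (zero , (-3 , -3) , -2 ∷ -2 ∷ [])
    ∷ (suc zero , (-3 , 1) , 80 ∷ [])
    ∷ (suc zero , (-3 , -2) , -34 ∷ [])
    ∷ []

  certificateForm : Form
  certificateForm = concatMap (λ (i , d , c) → scale c (eulerForm i d)) eulerCertificate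

  ⟦certificateForm⟧ : ∀ n → ⟦ certificateForm ⟧ (+ n) (freeWalks n) ≡ 0ℤ
  ⟦certificateForm⟧ n =
    trans (∑-concatMap (λ (i , d , c) → scale c (eulerForm i d)) eulerCertificate
                       (λ (c , p) → eval c (+ n) * freeWalks n p))
          (∑-zero eulerCertificate (All.universal (λ (i , d , c) →
            trans (⟦scale⟧ c (eulerForm i d) (+ n) (freeWalks n))
                  (trans (cong (eval c (+ n) *_) (⟦eulerForm⟧ i d n)) (*-zeroʳ (eval c (+ n))))) eulerCertificate))

  -- 8(n+1)(n+2), 7n²+49n+82 and -(n+5)(n+6)
  p₀ p₁ p₂ : Poly
  p₀ = 16 ∷ 24 ∷ 8 ∷ []
  p₁ = 82 ∷ 49 ∷ 7 ∷ []
  p₂ = -30 ∷ -11 ∷ -1 ∷ []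

  recurrenceForm : Form
  recurrenceForm =
    scale p₀ (boundaryForm 0) ++ scale p₁ (boundaryForm 1) ++ scale p₂ (boundaryForm 2) ++ certificateForm

  open Normalise canonical

  boundarySum-recurrence : ∀ n →
    8 * (+ n + 1) * (+ n + 2) * boundarySum n + (7 * + n * + n + 49 * + n + 82) * boundarySum (suc n)
    ≡ (+ n + 5) * (+ n + 6) * boundarySum (suc (suc n))
  boundarySum-recurrence n = rearrange (+ n) (boundarySum n) (boundarySum (suc n)) (boundarySum (suc (suc n))) (begin
      eval p₀ x * boundarySum n + (eval p₁ x * boundarySum (suc n) + (eval p₂ x * boundarySum (suc (suc n)) + 0ℤ))
    ≡⟨ cong₂ _+_ (term p₀ 0) (cong₂ _+_ (term p₁ 1) (cong₂ _+_ (term p₂ 2) (sym (⟦certificateForm⟧ n)))) ⟩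
      ⟦ a ⟧ x U + (⟦ b ⟧ x U + (⟦ c ⟧ x U + ⟦ certificateForm ⟧ x U))
    ≡⟨ sym (trans (⟦++⟧ a (b ++ c ++ certificateForm)) (cong (_+_ (⟦ a ⟧ x U))
             (trans (⟦++⟧ b (c ++ certificateForm)) (cong (_+_ (⟦ b ⟧ x U)) (⟦++⟧ c certificateForm))))) ⟩
      ⟦ recurrenceForm ⟧ x U
    ≡⟨ vanishes recurrenceForm _ x U (freeWalks-canonical n) ⟩
      0ℤ
    ∎)
    where
    open ≡-Reasoning
    x : ℤ
    x = + n
    U : ℤ² → ℤ
    U = freeWalks n
    a b c : Form
    a = scale p₀ (boundaryForm 0)
    b = scale p₁ (boundaryForm 1)
    c = scale p₂ (boundaryForm 2)
    ⟦++⟧ : ∀ φ ψ → ⟦ φ ++ ψ ⟧ x U ≡ ⟦ φ ⟧ x U + ⟦ ψ ⟧ x U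
    ⟦++⟧ φ ψ = ∑-++ φ ψ (λ (c , p) → eval c x * U p)
    term : ∀ p k → eval p x * boundarySum (k ℕ.+ n) ≡ ⟦ scale p (boundaryForm k) ⟧ x U
    term p k = sym (trans (⟦scale⟧ p (boundaryForm k) x U) (cong (eval p x *_) (⟦boundaryForm⟧ k n)))
    rearrange : ∀ x b₀ b₁ b₂ → eval p₀ x * b₀ + (eval p₁ x * b₁ + (eval p₂ x * b₂ + 0ℤ)) ≡ 0ℤ →
      8 * (x + 1) * (x + 2) * b₀ + (7 * x * x + 49 * x + 82) * b₁ ≡ (x + 5) * (x + 6) * b₂
    rearrange x b₀ b₁ b₂ eq = trans (regroup x b₀ b₁ b₂) (trans (cong (_+_ ((x + 5) * (x + 6) * b₂)) eq) (+-identityʳ _))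
      where
      regroup : ∀ x b₀ b₁ b₂ → + 8 * (x + 1ℤ) * (x + + 2) * b₀ + (+ 7 * x * x + + 49 * x + + 82) * b₁
        ≡ (x + + 5) * (x + + 6) * b₂ + ((+ 16 + x * (+ 24 + x * (+ 8 + x * 0ℤ))) * b₀
            + ((+ 82 + x * (+ 49 + x * (+ 7 + x * 0ℤ))) * b₁ + ((- + 30 + x * (- + 11 + x * (- 1ℤ + x * 0ℤ))) * b₂ + 0ℤ)))
      regroup = solve-∀

module WalksFromAxis where

  open import Data.Nat using (ℕ; suc; _+_; _*_; _≤_; z≤n)
  import Data.Nat.Properties as ℕ
  open import Data.Nat.ListAction using (sum)
  open import Data.Integer using (ℤ; +_; 0ℤ)
  import Data.Integer as ℤ
  open import Data.Integer.Properties using (pos-*; +-injective)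
  open import Data.Fin using (Fin)
  open import Data.Product using (Σ; _,_)
  open import Data.List using ([]; _∷_; map; upTo; applyUpTo)
  open import Data.List.Properties using (map-applyUpTo)
  open import Function.Bundles using (_↔_)
  open import Relation.Binary.PropositionalEquality using (_≡_; refl; sym; trans; cong; cong₂; subst; module ≡-Reasoning)
  open IntegerSums
  open ReflectionPrinciple
  open Telescoping
  open Recurrence
  open HesitatingWalkCount
  open CountIsSignedWalks

  -- Walks of length 2n from (i , 0) to (1 , 0) need i ≤ n + 1.
  axisWalks : ℕ → ℕ
  axisWalks n = sum (applyUpTo (λ i → count n (i , 0)) (suc (suc n)))

  axisWalks↔ : ∀ n → Fin (axisWalks n) ↔ Σ ℕ (λ i → HWalk n (i , 0) (1 , 0))
  axisWalks↔ n = sum-applyUpTo↔ (suc (suc n)) (λ i → walks↔ n (i , 0))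
    (λ i 2+n≤i w → ℕ.<-irrefl refl (ℕ.≤-trans 2+n≤i (subst (i ≤_) (ℕ.+-comm n 1) (walk-proj₁≤ w))))

  +sum : ∀ xs → + sum xs ≡ ∑ xs (λ x → + x)
  +sum []       = refl
  +sum (x ∷ xs) = cong (ℤ._+_ (+ x)) (+sum xs)

  axisWalks≡boundarySum : ∀ n → + axisWalks n ≡ boundarySum n
  axisWalks≡boundarySum n = begin
      + sum (applyUpTo c (suc (suc n)))
    ≡⟨ +sum (applyUpTo c (suc (suc n))) ⟩
      ∑ (applyUpTo c (suc (suc n))) (λ x → + x)
    ≡⟨ cong (λ xs → ∑ xs (λ x → + x)) (sym (map-applyUpTo (λ i → i) c (suc (suc n)))) ⟩
      ∑ (map c (upTo (suc (suc n)))) (λ x → + x)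
    ≡⟨ ∑-map c (upTo (suc (suc n))) (λ x → + x) ⟩
      ∑ (upTo (suc (suc n))) (λ i → + c i)
    ≡⟨ ∑-cong (upTo (suc (suc n))) (λ i → count≡signedWalks n i 0 z≤n) ⟩
      ∑ (upTo (suc (suc n))) (λ i → signedWalks n (+ i , 0ℤ))
    ≡⟨ ∑-signedWalks-axis n ⟩
      boundarySum n
    ∎
    where
    open ≡-Reasoning
    c : ℕ → ℕ
    c i = count n (i , 0)

  axisWalks-recurrence : ∀ n → 8 * (n + 1) * (n + 2) * axisWalks n + (7 * n * n + 49 * n + 82) * axisWalks (n + 1)
                              ≡ (n + 5) * (n + 6) * axisWalks (n + 2)
  axisWalks-recurrence n = +-injective (begin
      + (8 * (n + 1) * (n + 2) * E₀ + (7 * n * n + 49 * n + 82) * E₁)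
    ≡⟨ cong₂ ℤ._+_ (pos-*₄ 8 (n + 1) (n + 2) E₀)
                   (trans (pos-* (7 * n * n + 49 * n + 82) E₁)
                          (cong (ℤ._* + E₁) (cong₂ (λ x y → x ℤ.+ y ℤ.+ 82) (pos-*₃ 7 n n) (pos-* 49 n)))) ⟩
      P₀ ℤ.* + E₀ ℤ.+ P₁ ℤ.* + E₁
    ≡⟨ cong₂ (λ x y → P₀ ℤ.* x ℤ.+ P₁ ℤ.* y) (axisWalks≡boundarySum n) (shifted 1) ⟩
      P₀ ℤ.* boundarySum n ℤ.+ P₁ ℤ.* boundarySum (suc n)
    ≡⟨ boundarySum-recurrence n ⟩
      P₂ ℤ.* boundarySum (suc (suc n))
    ≡⟨ cong (P₂ ℤ.*_) (sym (shifted 2)) ⟩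
      P₂ ℤ.* + E₂
    ≡⟨ sym (pos-*₃ (n + 5) (n + 6) E₂) ⟩
      + ((n + 5) * (n + 6) * E₂)
    ∎)
    where
    open ≡-Reasoning
    E₀ E₁ E₂ : ℕ
    E₀ = axisWalks n
    E₁ = axisWalks (n + 1)
    E₂ = axisWalks (n + 2)
    P₀ P₁ P₂ : ℤ
    P₀ = 8 ℤ.* (+ n ℤ.+ 1) ℤ.* (+ n ℤ.+ 2)
    P₁ = 7 ℤ.* + n ℤ.* + n ℤ.+ 49 ℤ.* + n ℤ.+ 82
    P₂ = (+ n ℤ.+ 5) ℤ.* (+ n ℤ.+ 6)
    shifted : ∀ k → + axisWalks (n + k) ≡ boundarySum (k + n)
    shifted k = trans (cong (λ m → + axisWalks m) (ℕ.+-comm n k)) (axisWalks≡boundarySum (k + n))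
    pos-*₃ : ∀ a b c → + (a * b * c) ≡ + a ℤ.* + b ℤ.* + c
    pos-*₃ a b c = trans (pos-* (a * b) c) (cong (ℤ._* + c) (pos-* a b))
    pos-*₄ : ∀ a b c d → + (a * b * c * d) ≡ + a ℤ.* + b ℤ.* + c ℤ.* + d
    pos-*₄ a b c d = trans (pos-* (a * b * c) d) (cong (ℤ._* + d) (pos-*₃ a b c))

open import Data.Nat using (ℕ; _+_; _*_)
open import Data.Fin using (Fin)
open import Data.Product using (Σ; _×_; _,_)
open import Function.Bundles using (_↔_)
open import Relation.Binary.PropositionalEquality using (_≡_; refl)
open WalksFromAxis using (axisWalks; axisWalks↔; axisWalks-recurrence)

proposition13 : Σ (ℕ → ℕ) λ E →
    ((n : ℕ) → Fin (E n) ↔ Σ ℕ (λ i → HWalk n (i , 0) (1 , 0)))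
    × E 0 ≡ 1
    × E 1 ≡ 2
    × ((n : ℕ) → 8 * (n + 1) * (n + 2) * E n + (7 * n * n + 49 * n + 82) * E (n + 1)
                   ≡ (n + 5) * (n + 6) * E (n + 2))
proposition13 = axisWalks , axisWalks↔ , refl , refl , axisWalks-recurrence
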